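{- For every integer $n \ge 15$, the doubly metric dimension of the Kneser graph $K_{n,2}$ is $\psi(K_{n,2}) = \lceil 2n/3 \rceil$.
   Context: The Kneser graph $K_{n,2}$ has as vertices all $2$-element subsets of $[n]=\{1,\dots,n\}$, two being adjacent iff they are disjoint; $d$ denotes shortest-path distance. Vertices $x,y$ doubly resolve vertices $u,v$ if $d(u,x)-d(u,y)\ne d(v,x)-d(v,y)$. A vertex set $D$ is a doubly resolving set if every two distinct vertices are doubly resolved by some two vertices of $D$; $\psi(G)$ is the minimum cardinality of a doubly resolving set of $G$. -}

module Defs where

open import Data.Nat using (ℕ; zero; suc; _+_; _*_; _≤_)
open import Data.Nat.DivMod using (_/_)
open import Data.Fin using (Fin; _<_)
open import Data.Integer using (ℤ; +_; _-_)
open import Data.Product using (Σ; _×_; _,_; proj₁; proj₂)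
open import Data.List using (List; length)
open import Data.List.Membership.Propositional using (_∈_)
open import Data.List.Relation.Unary.Unique.Propositional using (Unique)
open import Relation.Binary.PropositionalEquality using (_≡_; _≢_)

-- Vertices of K_{n,2}: 2-element subsets {i,j} of [n], encoded uniquely as i < j.
Vertex : ℕ → Set
Vertex n = Σ (Fin n × Fin n) (λ p → proj₁ p < proj₂ p)

fst snd : ∀ {n} → Vertex n → Fin n
fst u = proj₁ (proj₁ u)
snd u = proj₂ (proj₁ u)

Adj : ∀ {n} → Vertex n → Vertex n → Set
Adj u v = (fst u ≢ fst v) × (fst u ≢ snd v) × (snd u ≢ fst v) × (snd u ≢ snd v)

data Walk {n : ℕ} : Vertex n → Vertex n → ℕ → Set where
  here : ∀ {u} → Walk u u 0
  step : ∀ {u w v k} → Adj u w → Walk w v k → Walk u v (suc k)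

Dist : ∀ {n} → Vertex n → Vertex n → ℕ → Set
Dist u v k = Walk u v k × (∀ m → Walk u v m → k ≤ m)

DoublyResolves : ∀ {n} → Vertex n → Vertex n → Vertex n → Vertex n → Set
DoublyResolves x y u v =
  ∀ a b c e → Dist u x a → Dist u y b → Dist v x c → Dist v y e →
  (+ a - + b) ≢ (+ c - + e)

-- D (a duplicate-free list of vertices, i.e. a vertex set) is doubly resolving.
DoublyResolving : ∀ {n} → List (Vertex n) → Set
DoublyResolving {n} D =
  ∀ (u v : Vertex n) → u ≢ v →
  Σ (Vertex n) λ x → Σ (Vertex n) λ y → x ∈ D × y ∈ D × DoublyResolves x y u v

IsPsi : ℕ → ℕ → Set
IsPsi n m =
  Σ (List (Vertex n)) (λ D → Unique D × DoublyResolving D × length D ≡ m)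
  × (∀ (D : List (Vertex n)) → Unique D → DoublyResolving D → m ≤ length D)

ceil2n/3 : ℕ → ℕ
ceil2n/3 n = (2 * n + 2) / 3

-- In K(n,2) with n ≥ 6 the distance between two 2-sets depends only on the size of their
-- intersection (2 ↦ 0, 0 ↦ 1, 1 ↦ 2). Hence x, y doubly resolve u, v whenever x meets u and v
-- in different numbers of points while y meets them equally often, and u, v are never doubly
-- resolved when every landmark meets them equally often.
--
-- Lower bound: read a doubly resolving set D as a graph on [n]. No two points can have the same
-- incident edges, so at most one point and no edge is isolated, and when a point is isolated no
-- point of degree 2 has two neighbours of degree 1. Discharging then gives 2n ≤ 3|D| if every
-- point is covered and 3(n − 1) ≤ 4|D| otherwise; both imply 2n ≤ 3|D| once n ≥ 9.
--
-- Upper bound: write n = 3k + r with r < 3 and split [n] into k ≥ 5 stars, each a centre with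
-- two leaves, r extra leaves hanging at one of them. The 2k + r leaf edges meet different 2-sets
-- in different patterns, and for any u, v some star avoids u ∪ v, so its leaf edge misses both.

module Submission where

open import Defs
open import Data.Nat using (ℕ; zero; suc; _+_; _*_; _∸_; _<_; _≤_; z≤n; s≤s; _≟_; _<?_)
import Data.Nat.Properties as ℕ
open import Data.Nat.DivMod
  using (_/_; _%_; m*n/n≡m; m<n⇒m/n≡0; +-distrib-/-∣ˡ; /-monoˡ-≤; m%n<n; m≡m%n+[m/n]*n)
open import Data.Nat.Divisibility using (divides)
open import Data.Nat.ListAction using (sum)
open import Data.Nat.Solver using (module +-*-Solver)
open import Data.Fin using (Fin; toℕ; fromℕ<; _↑ˡ_; _↑ʳ_; splitAt; combine; quotient)
open import Data.Fin.Patterns using (0F; 1F)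
import Data.Fin.Properties as Fin
import Data.Integer as ℤ
import Data.Integer.Properties as ℤ
open import Data.Bool using (if_then_else_)
open import Data.Empty using (⊥; ⊥-elim)
open import Data.Product using (Σ; ∃-syntax; _×_; _,_; proj₁; proj₂)
open import Data.Sum using (_⊎_; inj₁; inj₂; [_,_]′)
open import Data.List using (List; []; _∷_; length; lookup; filter; map; tabulate)
open import Data.List.Properties using (filter-accept; filter-reject; length-tabulate)
open import Data.List.Membership.Propositional using (_∈_; _∉_; find)
open import Data.List.Membership.Propositional.Properties using (∈-filter⁺; ∈-filter⁻; ∈-tabulate⁺)
open import Data.List.Relation.Unary.All as All using (All; []; _∷_)
open import Data.List.Relation.Unary.All.Properties using (¬Any⇒All¬; ¬All⇒Any¬)
open import Data.List.Relation.Unary.Any as Any using (here; there)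
open import Data.List.Relation.Unary.Any.Properties using (lookup-index)
open import Data.List.Relation.Unary.Unique.Propositional using (Unique; []; _∷_)
import Data.List.Relation.Unary.Unique.Propositional.Properties as Unique
open import Function using (_∘_; id)
open import Relation.Nullary using (¬_; Dec; yes; no; does; contradiction)
open import Relation.Nullary.Decidable using (dec-true; dec-false)
open import Relation.Binary.PropositionalEquality
open import Algebra.Properties.AbelianGroup ℤ.+-0-abelianGroup using (∙-cancelʳ)
open import Algebra.Properties.CommutativeSemigroup ℕ.+-commutativeSemigroup using (interchange)
open import Algebra.Properties.CommutativeMonoid.Sum ℕ.+-0-commutativeMonoid
  using (sum-syntax; sum-cong-≗; ∑-distrib-+; sum-replicate-zero)

-- Intersections of 2-sets

≤1+≤1≡2 : ∀ {a b} → a ≤ 1 → b ≤ 1 → a + b ≡ 2 → a ≡ 1 × b ≡ 1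
≤1+≤1≡2 (s≤s z≤n) (s≤s z≤n) _ = refl , refl
≤1+≤1≡2 z≤n       (s≤s z≤n) ()
≤1+≤1≡2 z≤n       z≤n       ()
≤1+≤1≡2 (s≤s z≤n) z≤n       ()

suc≡≤1⇒≡1 : ∀ {x y} → y ≤ 1 → suc x ≡ y → y ≡ 1
suc≡≤1⇒≡1 (s≤s z≤n) _ = refl

opaque
  δ : ∀ {n} → Fin n → Fin n → ℕ
  δ i j = if does (i Fin.≟ j) then 1 else 0

  δ-≡ : ∀ {n} {i j : Fin n} → i ≡ j → δ i j ≡ 1
  δ-≡ {i = i} {j} i≡j with i Fin.≟ j
  ... | yes _   = refl
  ... | no  i≢j = contradiction i≡j i≢j

  δ-≢ : ∀ {n} {i j : Fin n} → i ≢ j → δ i j ≡ 0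
  δ-≢ {i = i} {j} i≢j with i Fin.≟ j
  ... | yes i≡j = contradiction i≡j i≢j
  ... | no  _   = refl

  δ-suc : ∀ {n} {i j : Fin n} → δ (Fin.suc i) (Fin.suc j) ≡ δ i j
  δ-suc = refl

δ-refl : ∀ {n} {i : Fin n} → δ i i ≡ 1
δ-refl = δ-≡ refl

δ-sym : ∀ {n} (i j : Fin n) → δ i j ≡ δ j i
δ-sym i j with i Fin.≟ j
... | yes i≡j = trans (δ-≡ i≡j) (sym (δ-≡ (sym i≡j)))
... | no  i≢j = trans (δ-≢ i≢j) (sym (δ-≢ (i≢j ∘ sym)))

module _ {n : ℕ} where

  χ : Vertex n → Fin n → ℕ
  χ z i = δ i (fst z) + δ i (snd z)

  ∣_∩_∣ : Vertex n → Vertex n → ℕ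
  ∣ u ∩ w ∣ = χ w (fst u) + χ w (snd u)

  fst≢snd : ∀ (z : Vertex n) → fst z ≢ snd z
  fst≢snd (_ , fst<snd) fst≡snd = ℕ.<-irrefl (cong toℕ fst≡snd) fst<snd

  χ-fst : ∀ z → χ z (fst z) ≡ 1
  χ-fst z rewrite δ-refl {i = fst z} | δ-≢ (fst≢snd z) = refl

  χ-snd : ∀ z → χ z (snd z) ≡ 1
  χ-snd z rewrite δ-refl {i = snd z} | δ-≢ (fst≢snd z ∘ sym) = refl

  χ-∉ : ∀ {z i} → i ≢ fst z → i ≢ snd z → χ z i ≡ 0
  χ-∉ i≢fst i≢snd rewrite δ-≢ i≢fst | δ-≢ i≢snd = refl

  χ≡1⇒∈ : ∀ {z i} → χ z i ≡ 1 → i ≡ fst z ⊎ i ≡ snd z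
  χ≡1⇒∈ {z} {i} χ≡1 = decide (i Fin.≟ fst z) (i Fin.≟ snd z)
    where
    decide : Dec (i ≡ fst z) → Dec (i ≡ snd z) → i ≡ fst z ⊎ i ≡ snd z
    decide (yes i≡fst) _           = inj₁ i≡fst
    decide (no _)      (yes i≡snd) = inj₂ i≡snd
    decide (no i≢fst)  (no i≢snd)  = contradiction (trans (sym (χ-∉ {z} i≢fst i≢snd)) χ≡1) ℕ.0≢1+n

  χ-0or1 : ∀ z i → χ z i ≡ 0 ⊎ χ z i ≡ 1
  χ-0or1 z i = decide (i Fin.≟ fst z) (i Fin.≟ snd z)
    where
    decide : Dec (i ≡ fst z) → Dec (i ≡ snd z) → χ z i ≡ 0 ⊎ χ z i ≡ 1
    decide (yes refl) _          = inj₂ (χ-fst z)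
    decide (no _)     (yes refl) = inj₂ (χ-snd z)
    decide (no i≢fst) (no i≢snd) = inj₁ (χ-∉ {z} i≢fst i≢snd)

  χ≤1 : ∀ z i → χ z i ≤ 1
  χ≤1 z i with χ-0or1 z i
  ... | inj₁ χ≡0 rewrite χ≡0 = z≤n
  ... | inj₂ χ≡1 rewrite χ≡1 = s≤s z≤n

  χ≡0⇒∉ : ∀ {z i} → χ z i ≡ 0 → i ≢ fst z × i ≢ snd z
  χ≡0⇒∉ {z} χ≡0 = (λ { refl → ℕ.0≢1+n (trans (sym χ≡0) (χ-fst z)) })
                , (λ { refl → ℕ.0≢1+n (trans (sym χ≡0) (χ-snd z)) })

  χ-two : ∀ {q a b x} → a ≢ b → χ q a ≡ 1 → χ q b ≡ 1 → χ q x ≡ 1 → x ≡ a ⊎ x ≡ b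
  χ-two {q} {a} {b} {x} a≢b a∈q b∈q x∈q
    with χ≡1⇒∈ {q} {a} a∈q | χ≡1⇒∈ {q} {b} b∈q | χ≡1⇒∈ {q} {x} x∈q
  ... | inj₁ refl | inj₁ refl | _         = contradiction refl a≢b
  ... | inj₂ refl | inj₂ refl | _         = contradiction refl a≢b
  ... | inj₁ refl | inj₂ refl | inj₁ refl = inj₁ refl
  ... | inj₁ refl | inj₂ refl | inj₂ refl = inj₂ refl
  ... | inj₂ refl | inj₁ refl | inj₁ refl = inj₂ refl
  ... | inj₂ refl | inj₁ refl | inj₂ refl = inj₁ refl

  vertex-≡ : ∀ {u v : Vertex n} → fst u ≡ fst v → snd u ≡ snd v → u ≡ v
  vertex-≡ {(a , b) , a<b} {(_ , _) , a<b′} refl refl = cong ((a , b) ,_) (ℕ.<-irrelevant a<b a<b′)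

  ⊆⇒≡ : ∀ {u v} → χ v (fst u) ≡ 1 → χ v (snd u) ≡ 1 → u ≡ v
  ⊆⇒≡ {u} {v} fst∈ snd∈ with χ≡1⇒∈ {v} fst∈ | χ≡1⇒∈ {v} snd∈
  ... | inj₁ p | inj₁ q = contradiction (trans p (sym q)) (fst≢snd u)
  ... | inj₂ p | inj₂ q = contradiction (trans p (sym q)) (fst≢snd u)
  ... | inj₁ p | inj₂ q = vertex-≡ p q
  ... | inj₂ p | inj₁ q =
    contradiction (subst₂ (λ a b → toℕ a < toℕ b) (sym q) (sym p) (proj₂ v)) (ℕ.<-asym (proj₂ u))

  pair : (p q : Fin n) → p ≢ q → Vertex n
  pair p q p≢q with toℕ p <? toℕ q
  ... | yes p<q = (p , q) , p<q
  ... | no  p≮q = (q , p) , ℕ.≤∧≢⇒< (ℕ.≮⇒≥ p≮q) (p≢q ∘ sym ∘ Fin.toℕ-injective)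

  pair-< : ∀ {p q} (p≢q : p ≢ q) → toℕ p < toℕ q → fst (pair p q p≢q) ≡ p × snd (pair p q p≢q) ≡ q
  pair-< {p} {q} p≢q p<q with toℕ p <? toℕ q
  ... | yes _   = refl , refl
  ... | no  p≮q = contradiction p<q p≮q

  χ-pair : ∀ p q (p≢q : p ≢ q) x → χ (pair p q p≢q) x ≡ δ x p + δ x q
  χ-pair p q p≢q x with toℕ p <? toℕ q
  ... | yes _ = refl
  ... | no  _ = ℕ.+-comm (δ x q) (δ x p)

  χ-pairˡ : ∀ {p q} {p≢q : p ≢ q} → χ (pair p q p≢q) p ≡ 1
  χ-pairˡ {p} {q} {p≢q} rewrite χ-pair p q p≢q p | δ-refl {i = p} | δ-≢ p≢q = refl

  χ-pair-∉ : ∀ {p q} {p≢q : p ≢ q} {x} → x ≢ p → x ≢ q → χ (pair p q p≢q) x ≡ 0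
  χ-pair-∉ {p} {q} {p≢q} {x} x≢p x≢q rewrite χ-pair p q p≢q x | δ-≢ x≢p | δ-≢ x≢q = refl

  pair≢ : ∀ {p q} {p≢q : p ≢ q} {v} → χ v p ≡ 0 → pair p q p≢q ≢ v
  pair≢ {p} {q} {p≢q} p∉v refl = ℕ.1+n≢0 (trans (sym (χ-pairˡ {p} {q} {p≢q})) p∉v)

  ∣pair∩∣ : ∀ p q (p≢q : p ≢ q) w → ∣ pair p q p≢q ∩ w ∣ ≡ χ w p + χ w q
  ∣pair∩∣ p q p≢q w with toℕ p <? toℕ q
  ... | yes _ = refl
  ... | no  _ = ℕ.+-comm (χ w q) (χ w p)

  ∣∩∣-comm : ∀ u w → ∣ u ∩ w ∣ ≡ ∣ w ∩ u ∣
  ∣∩∣-comm u w = begin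
    (δ (fst u) (fst w) + δ (fst u) (snd w)) + (δ (snd u) (fst w) + δ (snd u) (snd w))
      ≡⟨ interchange (δ (fst u) (fst w)) (δ (fst u) (snd w)) (δ (snd u) (fst w)) (δ (snd u) (snd w)) ⟩
    (δ (fst u) (fst w) + δ (snd u) (fst w)) + (δ (fst u) (snd w) + δ (snd u) (snd w))
      ≡⟨ cong₂ _+_ (cong₂ _+_ (δ-sym (fst u) (fst w)) (δ-sym (snd u) (fst w)))
                   (cong₂ _+_ (δ-sym (fst u) (snd w)) (δ-sym (snd u) (snd w))) ⟩
    (δ (fst w) (fst u) + δ (fst w) (snd u)) + (δ (snd w) (fst u) + δ (snd w) (snd u))  ∎
    where open ≡-Reasoning

  ∣∩pair∣ : ∀ w p q (p≢q : p ≢ q) → ∣ w ∩ pair p q p≢q ∣ ≡ χ w p + χ w q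
  ∣∩pair∣ w p q p≢q = trans (∣∩∣-comm w (pair p q p≢q)) (∣pair∩∣ p q p≢q w)

  ∣∩∣≤2 : ∀ u w → ∣ u ∩ w ∣ ≤ 2
  ∣∩∣≤2 u w = ℕ.+-mono-≤ (χ≤1 w (fst u)) (χ≤1 w (snd u))

  ∣∩∣-self : ∀ u → ∣ u ∩ u ∣ ≡ 2
  ∣∩∣-self u rewrite χ-fst u | χ-snd u = refl

  ∣∩∣≡2⇒≡ : ∀ {u w} → ∣ u ∩ w ∣ ≡ 2 → u ≡ w
  ∣∩∣≡2⇒≡ {u} {w} eq with fst∈ , snd∈ ← ≤1+≤1≡2 (χ≤1 w (fst u)) (χ≤1 w (snd u)) eq = ⊆⇒≡ fst∈ snd∈

  Adj⇒∣∩∣≡0 : ∀ {u w} → Adj u w → ∣ u ∩ w ∣ ≡ 0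
  Adj⇒∣∩∣≡0 {u} {w} (ff , fs , sf , ss) rewrite χ-∉ {w} ff fs | χ-∉ {w} sf ss = refl

  ∣∩∣≡0⇒Adj : ∀ {u w} → ∣ u ∩ w ∣ ≡ 0 → Adj u w
  ∣∩∣≡0⇒Adj {u} {w} eq
    with ff , fs ← χ≡0⇒∉ {w} (ℕ.m+n≡0⇒m≡0 (χ w (fst u)) eq)
       | sf , ss ← χ≡0⇒∉ {w} (ℕ.m+n≡0⇒n≡0 (χ w (fst u)) eq)
    = ff , fs , sf , ss

  Adj-sym : ∀ {u w : Vertex n} → Adj u w → Adj w u
  Adj-sym (ff , fs , sf , ss) = ff ∘ sym , sf ∘ sym , fs ∘ sym , ss ∘ sym

  other : Vertex n → Fin n → Fin n
  other z i = if does (i Fin.≟ fst z) then snd z else fst z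

  other-fst : ∀ z → other z (fst z) ≡ snd z
  other-fst z rewrite dec-true (fst z Fin.≟ fst z) refl = refl

  other-snd : ∀ z → other z (snd z) ≡ fst z
  other-snd z rewrite dec-false (snd z Fin.≟ fst z) (fst≢snd z ∘ sym) = refl

  χ-other : ∀ {z i} → χ z i ≡ 1 → other z i ≢ i × χ z (other z i) ≡ 1
  χ-other {z} {i} i∈z with χ≡1⇒∈ {z} {i} i∈z
  ... | inj₁ refl rewrite other-fst z = fst≢snd z ∘ sym , χ-snd z
  ... | inj₂ refl rewrite other-snd z = fst≢snd z , χ-fst z

  Unseparated : List (Vertex n) → Vertex n → Vertex n → Set
  Unseparated D u v = ∀ {w} → w ∈ D → ∣ u ∩ w ∣ ≡ ∣ v ∩ w ∣

fresh : ∀ {n} (xs : List (Fin n)) → length xs < n → ∃[ p ] p ∉ xs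
fresh {n} xs len<n = Fin.¬∀⟶∃¬ n (_∈ xs) (_∈? xs) all∈⇒⊥
  where
  open import Data.List.Membership.DecPropositional (Fin._≟_ {n}) using (_∈?_)
  all∈⇒⊥ : ¬ (∀ p → p ∈ xs)
  all∈⇒⊥ all∈ with i , j , i<j , same ← Fin.pigeonhole len<n (Any.index ∘ all∈) =
    ℕ.<-irrefl (cong toℕ i≡j) i<j
    where
    i≡j = trans (lookup-index (all∈ i)) (trans (cong (lookup xs) same) (sym (lookup-index (all∈ j))))

-- Distances

dist∩ : ℕ → ℕ
dist∩ 0 = 1
dist∩ 1 = 2
dist∩ _ = 0

dist∩≤2 : ∀ k → dist∩ k ≤ 2
dist∩≤2 0             = s≤s z≤n
dist∩≤2 1             = s≤s (s≤s z≤n)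
dist∩≤2 (suc (suc _)) = z≤n

dist∩-injective : ∀ {k l} → k ≤ 2 → l ≤ 2 → dist∩ k ≡ dist∩ l → k ≡ l
dist∩-injective {0} {0} _ _ _ = refl
dist∩-injective {1} {1} _ _ _ = refl
dist∩-injective {2} {2} _ _ _ = refl
dist∩-injective {0} {1} _ _ ()
dist∩-injective {0} {2} _ _ ()
dist∩-injective {1} {0} _ _ ()
dist∩-injective {1} {2} _ _ ()
dist∩-injective {2} {0} _ _ ()
dist∩-injective {2} {1} _ _ ()
dist∩-injective {suc (suc (suc _))} (s≤s (s≤s ())) _ _
dist∩-injective {_} {suc (suc (suc _))} _ (s≤s (s≤s ())) _

module _ {n : ℕ} where

  Walk⇒dist∩≤ : ∀ {u v : Vertex n} {m} → Walk u v m → dist∩ ∣ u ∩ v ∣ ≤ m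
  Walk⇒dist∩≤ {u} here rewrite ∣∩∣-self u = z≤n
  Walk⇒dist∩≤ {u} {v} (step u~v here) rewrite Adj⇒∣∩∣≡0 {u = u} {w = v} u~v = s≤s z≤n
  Walk⇒dist∩≤ {u} {v} (step _ (step _ _)) = ℕ.≤-trans (dist∩≤2 ∣ u ∩ v ∣) (s≤s (s≤s z≤n))

  Adj-pair : ∀ (u : Vertex n) {p q} (p≢q : p ≢ q) →
             fst u ≢ p → fst u ≢ q → snd u ≢ p → snd u ≢ q → Adj u (pair p q p≢q)
  Adj-pair u p≢q fst≢p fst≢q snd≢p snd≢q =
    ∣∩∣≡0⇒Adj {u = u} {w = pair _ _ p≢q} (cong₂ _+_ (χ-pair-∉ fst≢p fst≢q) (χ-pair-∉ snd≢p snd≢q))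

module _ {n : ℕ} (6≤n : 6 ≤ n) where

  common-neighbour : ∀ (u v : Vertex n) → ∃[ w ] Adj u w × Adj w v
  common-neighbour u v
    with p , p∉ ← fresh (fst u ∷ snd u ∷ fst v ∷ snd v ∷ []) (ℕ.≤-trans (ℕ.n≤1+n 5) 6≤n)
    with q , q∉ ← fresh (p ∷ fst u ∷ snd u ∷ fst v ∷ snd v ∷ []) 6≤n
    with p≢u₁ ∷ p≢u₂ ∷ p≢v₁ ∷ p≢v₂ ∷ [] ← ¬Any⇒All¬ _ p∉
    with q≢p ∷ q≢u₁ ∷ q≢u₂ ∷ q≢v₁ ∷ q≢v₂ ∷ [] ← ¬Any⇒All¬ _ q∉
    = w , Adj-pair u p≢q (p≢u₁ ∘ sym) (q≢u₁ ∘ sym) (p≢u₂ ∘ sym) (q≢u₂ ∘ sym)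
        , Adj-sym {u = v} {w = w} (Adj-pair v p≢q (p≢v₁ ∘ sym) (q≢v₁ ∘ sym) (p≢v₂ ∘ sym) (q≢v₂ ∘ sym))
    where
    p≢q = q≢p ∘ sym
    w = pair p q p≢q

  walk-dist∩ : ∀ (u v : Vertex n) → Walk u v (dist∩ ∣ u ∩ v ∣)
  walk-dist∩ u v = walk ∣ u ∩ v ∣ refl
    where
    walk : ∀ k → ∣ u ∩ v ∣ ≡ k → Walk u v (dist∩ k)
    walk 0 eq = step (∣∩∣≡0⇒Adj {u = u} {w = v} eq) here
    walk 1 _  = let w , u~w , w~v = common-neighbour u v in step {w = w} u~w (step {w = v} w~v here)
    walk 2 eq = subst (λ v → Walk u v 0) (∣∩∣≡2⇒≡ {u = u} {w = v} eq) here
    walk (suc (suc (suc _))) eq = contradiction (subst (_≤ 2) eq (∣∩∣≤2 u v)) λ { (s≤s (s≤s ())) }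

  Dist-dist∩ : ∀ u v → Dist u v (dist∩ ∣ u ∩ v ∣)
  Dist-dist∩ u v = walk-dist∩ u v , λ _ → Walk⇒dist∩≤

  Dist⇒≡dist∩ : ∀ {u v d} → Dist u v d → d ≡ dist∩ ∣ u ∩ v ∣
  Dist⇒≡dist∩ {u} {v} (walk , shortest) = ℕ.≤-antisym (shortest _ (walk-dist∩ u v)) (Walk⇒dist∩≤ walk)

  ¬DoublyResolves : ∀ {x y u v} → ∣ u ∩ x ∣ ≡ ∣ v ∩ x ∣ → ∣ u ∩ y ∣ ≡ ∣ v ∩ y ∣ →
                    ¬ DoublyResolves x y u v
  ¬DoublyResolves {x} {y} {u} {v} ux≡vx uy≡vy resolves =
    resolves _ _ _ _ (Dist-dist∩ u x) (Dist-dist∩ u y) (Dist-dist∩ v x) (Dist-dist∩ v y)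
             (cong₂ (λ a b → ℤ.+ dist∩ a ℤ.- ℤ.+ dist∩ b) ux≡vx uy≡vy)

  DoublyResolves-if : ∀ {x y u v} → ∣ u ∩ x ∣ ≢ ∣ v ∩ x ∣ → ∣ u ∩ y ∣ ≡ ∣ v ∩ y ∣ →
                      DoublyResolves x y u v
  DoublyResolves-if {x} {y} {u} {v} ux≢vx uy≡vy _ _ _ _ ux uy vx vy eq
    rewrite Dist⇒≡dist∩ ux | Dist⇒≡dist∩ uy | Dist⇒≡dist∩ vx | Dist⇒≡dist∩ vy | uy≡vy =
    ux≢vx (dist∩-injective (∣∩∣≤2 u x) (∣∩∣≤2 v x)
            (ℤ.+-injective (∙-cancelʳ (ℤ.- ℤ.+ dist∩ ∣ v ∩ y ∣) (ℤ.+ dist∩ ∣ u ∩ x ∣) (ℤ.+ dist∩ ∣ v ∩ x ∣)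
                                      eq)))

  DoublyResolving⇒separating : ∀ {D} → DoublyResolving D → ∀ {u v} → u ≢ v → ¬ Unseparated D u v
  DoublyResolving⇒separating resolving {u} {v} u≢v unseparated
    with x , y , x∈D , y∈D , resolves ← resolving u v u≢v
    = ¬DoublyResolves {x} {y} {u} {v} (unseparated x∈D) (unseparated y∈D) resolves

  DoublyResolving-if : ∀ {D} →
    (∀ {u v} → u ≢ v → ∃[ x ] x ∈ D × ∣ u ∩ x ∣ ≢ ∣ v ∩ x ∣) →
    (∀ u v → ∃[ y ] y ∈ D × ∣ u ∩ y ∣ ≡ ∣ v ∩ y ∣) →
    DoublyResolving D
  DoublyResolving-if separating balancing u v u≢v
    with x , x∈D , ux≢vx ← separating u≢v
       | y , y∈D , uy≡vy ← balancing u v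
    = x , y , x∈D , y∈D , DoublyResolves-if {x} {y} {u} {v} ux≢vx uy≡vy

-- Sums and degrees

∑∈ : ∀ {A : Set} → List A → (A → ℕ) → ℕ
∑∈ xs f = sum (map f xs)

infixl 10 ∑∈
syntax ∑∈ xs (λ z → e) = ∑[ z ∈ xs ] e

∑∈-≤ : ∀ {A : Set} {xs : List A} {f : A → ℕ} c → (∀ {z} → z ∈ xs → f z ≤ c) →
       ∑[ z ∈ xs ] f z ≤ length xs * c
∑∈-≤ {xs = []}     c f≤c = z≤n
∑∈-≤ {xs = x ∷ xs} c f≤c = ℕ.+-mono-≤ (f≤c (here refl)) (∑∈-≤ c (f≤c ∘ there))

∑-≥ : ∀ {n} {f : Fin n → ℕ} c → (∀ i → c ≤ f i) → n * c ≤ ∑[ i < n ] f i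
∑-≥ {zero}  c c≤f = z≤n
∑-≥ {suc n} c c≤f = ℕ.+-mono-≤ (c≤f Fin.zero) (∑-≥ c (c≤f ∘ Fin.suc))

∑-δ : ∀ {n} (a : Fin n) (f : Fin n → ℕ) → ∑[ i < n ] (δ i a * f i) ≡ f a
∑-δ {suc n} Fin.zero f = begin
  δ Fin.zero Fin.zero * f Fin.zero + ∑[ i < n ] (δ (Fin.suc i) Fin.zero * f (Fin.suc i))
    ≡⟨ cong₂ _+_ (cong (_* f Fin.zero) δ-refl) (sum-cong-≗ (λ i → cong (_* f (Fin.suc i)) (δ-≢ λ ()))) ⟩
  1 * f Fin.zero + ∑[ i < n ] 0
    ≡⟨ cong₂ _+_ (ℕ.*-identityˡ (f Fin.zero)) (sum-replicate-zero n) ⟩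
  f Fin.zero + 0
    ≡⟨ ℕ.+-identityʳ (f Fin.zero) ⟩
  f Fin.zero ∎
  where open ≡-Reasoning
∑-δ {suc n} (Fin.suc a) f = begin
  δ Fin.zero (Fin.suc a) * f Fin.zero + ∑[ i < n ] (δ (Fin.suc i) (Fin.suc a) * f (Fin.suc i))
    ≡⟨ cong₂ _+_ (cong (_* f Fin.zero) (δ-≢ λ ())) (sum-cong-≗ (λ i → cong (_* f (Fin.suc i)) δ-suc)) ⟩
  ∑[ i < n ] (δ i a * f (Fin.suc i))
    ≡⟨ ∑-δ a (f ∘ Fin.suc) ⟩
  f (Fin.suc a) ∎
  where open ≡-Reasoning

length≡0⇒≡[] : ∀ {A : Set} {xs : List A} → length xs ≡ 0 → xs ≡ []
length≡0⇒≡[] {xs = []} _ = refl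

length≡1⇒singleton : ∀ {A : Set} {xs : List A} {z} → length xs ≡ 1 → z ∈ xs → xs ≡ z ∷ []
length≡1⇒singleton {xs = _ ∷ []} _ (here refl) = refl

module _ {n : ℕ} where

  ∑-χ : ∀ z (f : Fin n → ℕ) → ∑[ i < n ] (χ z i * f i) ≡ f (fst z) + f (snd z)
  ∑-χ z f = begin
    ∑[ i < n ] (χ z i * f i)
      ≡⟨ sum-cong-≗ (λ i → ℕ.*-distribʳ-+ (f i) (δ i (fst z)) (δ i (snd z))) ⟩
    ∑[ i < n ] (δ i (fst z) * f i + δ i (snd z) * f i)
      ≡⟨ ∑-distrib-+ (λ i → δ i (fst z) * f i) (λ i → δ i (snd z) * f i) ⟩
    ∑[ i < n ] (δ i (fst z) * f i) + ∑[ i < n ] (δ i (snd z) * f i)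
      ≡⟨ cong₂ _+_ (∑-δ (fst z) f) (∑-δ (snd z) f) ⟩
    f (fst z) + f (snd z) ∎
    where open ≡-Reasoning

  edgesAt : List (Vertex n) → Fin n → List (Vertex n)
  edgesAt D i = filter (λ w → χ w i ≟ 1) D

  deg : List (Vertex n) → Fin n → ℕ
  deg D i = length (edgesAt D i)

  ∈-edgesAt⁺ : ∀ {D w i} → w ∈ D → χ w i ≡ 1 → w ∈ edgesAt D i
  ∈-edgesAt⁺ {i = i} = ∈-filter⁺ (λ w → χ w i ≟ 1)

  ∈-edgesAt⁻ : ∀ {D w i} → w ∈ edgesAt D i → w ∈ D × χ w i ≡ 1
  ∈-edgesAt⁻ {i = i} = ∈-filter⁻ (λ w → χ w i ≟ 1)

  ∑-edgesAt-∷ : ∀ d D i (g : Vertex n → ℕ) →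
                ∑[ z ∈ edgesAt (d ∷ D) i ] g z ≡ χ d i * g d + ∑[ z ∈ edgesAt D i ] g z
  ∑-edgesAt-∷ d D i g with χ-0or1 d i
  ... | inj₁ χ≡0 rewrite filter-reject (λ w → χ w i ≟ 1) {d} {D} (ℕ.0≢1+n ∘ trans (sym χ≡0)) | χ≡0 = refl
  ... | inj₂ χ≡1 rewrite filter-accept (λ w → χ w i ≟ 1) {d} {D} χ≡1 | χ≡1 =
    cong (_+ ∑[ z ∈ edgesAt D i ] g z) (sym (ℕ.+-identityʳ (g d)))

  double-counting : ∀ D (φ : Vertex n → Fin n → ℕ) →
    ∑[ i < n ] ∑[ z ∈ edgesAt D i ] φ z i ≡ ∑[ z ∈ D ] (φ z (fst z) + φ z (snd z))
  double-counting []      φ = sum-replicate-zero n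
  double-counting (d ∷ D) φ = begin
    ∑[ i < n ] ∑[ z ∈ edgesAt (d ∷ D) i ] φ z i
      ≡⟨ sum-cong-≗ (λ i → ∑-edgesAt-∷ d D i (λ z → φ z i)) ⟩
    ∑[ i < n ] (χ d i * φ d i + ∑[ z ∈ edgesAt D i ] φ z i)
      ≡⟨ ∑-distrib-+ (λ i → χ d i * φ d i) (λ i → ∑[ z ∈ edgesAt D i ] φ z i) ⟩
    ∑[ i < n ] (χ d i * φ d i) + ∑[ i < n ] ∑[ z ∈ edgesAt D i ] φ z i
      ≡⟨ cong₂ _+_ (∑-χ d (φ d)) (double-counting D φ) ⟩
    (φ d (fst d) + φ d (snd d)) + ∑[ z ∈ D ] (φ z (fst z) + φ z (snd z)) ∎
    where open ≡-Reasoning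

module _ {n : ℕ} {D : List (Vertex n)} where

  χ≡1⇒∈edgesAt : ∀ {x w ws} → edgesAt D x ≡ ws → w ∈ D → χ w x ≡ 1 → w ∈ ws
  χ≡1⇒∈edgesAt {w = w} at-x w∈D x∈w = subst (w ∈_) at-x (∈-edgesAt⁺ {D = D} w∈D x∈w)

  ∈edgesAt⇒χ≡1 : ∀ {x w ws} → edgesAt D x ≡ ws → w ∈ ws → χ w x ≡ 1
  ∈edgesAt⇒χ≡1 {w = w} at-x w∈ws = proj₂ (∈-edgesAt⁻ {D = D} (subst (w ∈_) (sym at-x) w∈ws))

  edgesAt-≡⇒χ-≡ : ∀ {a b w} → edgesAt D a ≡ edgesAt D b → w ∈ D → χ w a ≡ χ w b
  edgesAt-≡⇒χ-≡ {a} {b} {w} same w∈D with χ-0or1 w a | χ-0or1 w b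
  ... | inj₁ a∉w | inj₁ b∉w = trans a∉w (sym b∉w)
  ... | inj₂ a∈w | inj₂ b∈w = trans a∈w (sym b∈w)
  ... | inj₁ a∉w | inj₂ b∈w =
    contradiction (trans (sym a∉w) (∈edgesAt⇒χ≡1 refl (χ≡1⇒∈edgesAt (sym same) w∈D b∈w))) ℕ.0≢1+n
  ... | inj₂ a∈w | inj₁ b∉w =
    contradiction (trans (sym b∉w) (∈edgesAt⇒χ≡1 refl (χ≡1⇒∈edgesAt same w∈D a∈w))) ℕ.0≢1+n

  twins-unseparated : ∀ {a b k} (k≢a : k ≢ a) (k≢b : k ≢ b) → edgesAt D a ≡ edgesAt D b →
                      Unseparated D (pair a k (k≢a ∘ sym)) (pair b k (k≢b ∘ sym))
  twins-unseparated {a} {b} {k} k≢a k≢b same {w} w∈D = begin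
    ∣ pair a k _ ∩ w ∣  ≡⟨ ∣pair∩∣ a k (k≢a ∘ sym) w ⟩
    χ w a + χ w k      ≡⟨ cong (_+ χ w k) (edgesAt-≡⇒χ-≡ same w∈D) ⟩
    χ w b + χ w k      ≡⟨ ∣pair∩∣ b k (k≢b ∘ sym) w ⟨
    ∣ pair b k _ ∩ w ∣  ∎
    where open ≡-Reasoning

  cherry-unseparated : ∀ {i i₀ a c z z′} (a≢c : a ≢ c) (i≢i₀ : i ≢ i₀) → z ≢ z′ →
    edgesAt D i ≡ z ∷ z′ ∷ [] → edgesAt D a ≡ z ∷ [] → edgesAt D c ≡ z′ ∷ [] → edgesAt D i₀ ≡ [] →
    Unseparated D (pair a c a≢c) (pair i i₀ i≢i₀)
  cherry-unseparated {i} {i₀} {a} {c} {z} {z′} a≢c i≢i₀ z≢z′ at-i at-a at-c at-i₀ {w} w∈D = begin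
    ∣ pair a c a≢c ∩ w ∣    ≡⟨ ∣pair∩∣ a c a≢c w ⟩
    χ w a + χ w c          ≡⟨ counts (χ-0or1 w a) (χ-0or1 w c) ⟩
    χ w i + χ w i₀         ≡⟨ ∣pair∩∣ i i₀ i≢i₀ w ⟨
    ∣ pair i i₀ i≢i₀ ∩ w ∣  ∎
    where
    open ≡-Reasoning
    i₀∉w : χ w i₀ ≡ 0
    i₀∉w with χ-0or1 w i₀
    ... | inj₁ i₀∉w = i₀∉w
    ... | inj₂ i₀∈w with () ← χ≡1⇒∈edgesAt at-i₀ w∈D i₀∈w
    i∈w⇒w∈zz′ : χ w i ≡ 1 → w ≡ z ⊎ w ≡ z′
    i∈w⇒w∈zz′ i∈w with χ≡1⇒∈edgesAt at-i w∈D i∈w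
    ... | here w≡z          = inj₁ w≡z
    ... | there (here w≡z′) = inj₂ w≡z′
    counts : χ w a ≡ 0 ⊎ χ w a ≡ 1 → χ w c ≡ 0 ⊎ χ w c ≡ 1 → χ w a + χ w c ≡ χ w i + χ w i₀
    counts (inj₂ a∈w) (inj₂ c∈w)
      with here w≡z ← χ≡1⇒∈edgesAt at-a w∈D a∈w
         | here w≡z′ ← χ≡1⇒∈edgesAt at-c w∈D c∈w = contradiction (trans (sym w≡z) w≡z′) z≢z′
    counts (inj₂ a∈w) (inj₁ c∉w)
      with here w≡z ← χ≡1⇒∈edgesAt at-a w∈D a∈w
      rewrite a∈w | c∉w | i₀∉w | ∈edgesAt⇒χ≡1 at-i (here w≡z) = refl
    counts (inj₁ a∉w) (inj₂ c∈w)
      with here w≡z′ ← χ≡1⇒∈edgesAt at-c w∈D c∈w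
      rewrite a∉w | c∈w | i₀∉w | ∈edgesAt⇒χ≡1 at-i (there (here w≡z′)) = refl
    counts (inj₁ a∉w) (inj₁ c∉w) with χ-0or1 w i
    ... | inj₁ i∉w rewrite a∉w | c∉w | i∉w | i₀∉w = refl
    ... | inj₂ i∈w with i∈w⇒w∈zz′ i∈w
    ...   | inj₁ w≡z  = contradiction (trans (sym a∉w) (∈edgesAt⇒χ≡1 at-a (here w≡z))) ℕ.0≢1+n
    ...   | inj₂ w≡z′ = contradiction (trans (sym c∉w) (∈edgesAt⇒χ≡1 at-c (here w≡z′))) ℕ.0≢1+n

-- The lower bound

-- Discharging: an edge z gives each endpoint i a share depending on deg i and on the degree of
-- the other endpoint. If no point is isolated, every point collects at least 2 (shareA) and no
-- edge pays more than 3; if one point is isolated, every other point collects at least 3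
-- (shareB) and no edge pays more than 4.

shareA : ℕ → ℕ
shareA 1 = 2
shareA _ = 1

shareA-receipt : ∀ {A : Set} (zs : List A) → length zs ≢ 0 → 2 ≤ ∑[ z ∈ zs ] shareA (length zs)
shareA-receipt []           zs≢[] = contradiction refl zs≢[]
shareA-receipt (_ ∷ [])     _     = ℕ.≤-refl
shareA-receipt (_ ∷ _ ∷ _)  _     = s≤s (s≤s z≤n)

shareA-payment : ∀ a b → ¬ (a ≡ 1 × b ≡ 1) → shareA a + shareA b ≤ 3
shareA-payment 1             1             not-both = contradiction (refl , refl) not-both
shareA-payment 1             0             _ = ℕ.≤-refl
shareA-payment 1             (suc (suc _)) _ = ℕ.≤-refl
shareA-payment 0             1             _ = ℕ.≤-refl
shareA-payment (suc (suc _)) 1             _ = ℕ.≤-refl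
shareA-payment 0             0             _ = s≤s (s≤s z≤n)
shareA-payment 0             (suc (suc _)) _ = s≤s (s≤s z≤n)
shareA-payment (suc (suc _)) 0             _ = s≤s (s≤s z≤n)
shareA-payment (suc (suc _)) (suc (suc _)) _ = s≤s (s≤s z≤n)

shareB : ℕ → ℕ → ℕ
shareB 1 _ = 3
shareB _ 1 = 1
shareB _ _ = 2

shareB-payment : ∀ a b → ¬ (a ≡ 1 × b ≡ 1) → shareB a b + shareB b a ≤ 4
shareB-payment 1             1             not-both = contradiction (refl , refl) not-both
shareB-payment 1             0             _ = ℕ.≤-refl
shareB-payment 1             (suc (suc _)) _ = ℕ.≤-refl
shareB-payment 0             1             _ = ℕ.≤-refl
shareB-payment (suc (suc _)) 1             _ = ℕ.≤-refl
shareB-payment 0             0             _ = ℕ.≤-refl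
shareB-payment 0             (suc (suc _)) _ = ℕ.≤-refl
shareB-payment (suc (suc _)) 0             _ = ℕ.≤-refl
shareB-payment (suc (suc _)) (suc (suc _)) _ = ℕ.≤-refl

1≤shareB : ∀ a b → 1 ≤ shareB (2 + a) b
1≤shareB a 0             = s≤s z≤n
1≤shareB a 1             = s≤s z≤n
1≤shareB a (suc (suc _)) = s≤s z≤n

3≤shareB₂ : ∀ b b′ → ¬ (b ≡ 1 × b′ ≡ 1) → 3 ≤ shareB 2 b + shareB 2 b′
3≤shareB₂ 1             1             not-both = contradiction (refl , refl) not-both
3≤shareB₂ 1             0             _ = ℕ.≤-refl
3≤shareB₂ 1             (suc (suc _)) _ = ℕ.≤-refl
3≤shareB₂ 0             1             _ = ℕ.≤-refl
3≤shareB₂ (suc (suc _)) 1             _ = ℕ.≤-refl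
3≤shareB₂ 0             0             _ = s≤s (s≤s (s≤s z≤n))
3≤shareB₂ 0             (suc (suc _)) _ = s≤s (s≤s (s≤s z≤n))
3≤shareB₂ (suc (suc _)) 0             _ = s≤s (s≤s (s≤s z≤n))
3≤shareB₂ (suc (suc _)) (suc (suc _)) _ = s≤s (s≤s (s≤s z≤n))

shareB-receipt : ∀ {A : Set} (zs : List A) (d : A → ℕ) → length zs ≢ 0 →
                 (∀ {z z′} → zs ≡ z ∷ z′ ∷ [] → ¬ (d z ≡ 1 × d z′ ≡ 1)) →
                 3 ≤ ∑[ z ∈ zs ] shareB (length zs) (d z)
shareB-receipt []                 d zs≢[] _ = contradiction refl zs≢[]
shareB-receipt (_ ∷ [])           d _ _ = ℕ.≤-refl
shareB-receipt (z ∷ z′ ∷ [])      d _ no-cherry =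
  subst (3 ≤_) (cong (shareB 2 (d z) +_) (sym (ℕ.+-identityʳ _)))
        (3≤shareB₂ (d z) (d z′) (no-cherry refl))
shareB-receipt (z ∷ z′ ∷ z″ ∷ zs) d _ _ =
  ℕ.+-mono-≤ (1≤shareB _ (d z))
    (ℕ.+-mono-≤ (1≤shareB _ (d z′)) (ℕ.≤-trans (1≤shareB _ (d z″)) (ℕ.m≤m+n _ _)))

module _ {n : ℕ} (6≤n : 6 ≤ n) {D : List (Vertex n)} (resolving : DoublyResolving D) where

  no-twins : ∀ {a b} → a ≢ b → edgesAt D a ≢ edgesAt D b
  no-twins {a} {b} a≢b same
    with k , k∉ ← fresh (a ∷ b ∷ []) (ℕ.≤-trans (s≤s (s≤s (s≤s z≤n))) 6≤n)
    with k≢a ∷ k≢b ∷ [] ← ¬Any⇒All¬ _ k∉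
    = DoublyResolving⇒separating 6≤n resolving ak≢bk (twins-unseparated k≢a k≢b same)
    where
    ak≢bk : pair a k (k≢a ∘ sym) ≢ pair b k (k≢b ∘ sym)
    ak≢bk = pair≢ (χ-pair-∉ a≢b (k≢a ∘ sym))

  no-isolated-edge : ∀ {z} → z ∈ D → ¬ (deg D (fst z) ≡ 1 × deg D (snd z) ≡ 1)
  no-isolated-edge {z} z∈D (fst-leaf , snd-leaf) =
    no-twins (fst≢snd z) (trans (length≡1⇒singleton fst-leaf (∈-edgesAt⁺ {D = D} z∈D (χ-fst z)))
                          (sym (length≡1⇒singleton snd-leaf (∈-edgesAt⁺ {D = D} z∈D (χ-snd z)))))

  no-cherry : Unique D → ∀ {i i₀ z z′} → edgesAt D i₀ ≡ [] → edgesAt D i ≡ z ∷ z′ ∷ [] →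
              ¬ (deg D (other z i) ≡ 1 × deg D (other z′ i) ≡ 1)
  no-cherry unique {i} {i₀} {z} {z′} at-i₀ at-i (a-leaf , c-leaf)
    with (z≢z′ ∷ []) ∷ _ ← subst Unique at-i (Unique.filter⁺ (λ w → χ w i ≟ 1) unique)
    = DoublyResolving⇒separating 6≤n resolving ac≢ii₀
        (cherry-unseparated a≢c i≢i₀ z≢z′ at-i at-a at-c at-i₀)
    where
    a = other z i
    c = other z′ i
    edge-at-i : ∀ {w} → w ∈ z ∷ z′ ∷ [] → w ∈ D × other w i ≢ i × χ w (other w i) ≡ 1
    edge-at-i {w} w∈zz′ with w∈D , i∈w ← ∈-edgesAt⁻ {D = D} (subst (w ∈_) (sym at-i) w∈zz′)
      = w∈D , χ-other {z = w} {i = i} i∈w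
    at-a : edgesAt D a ≡ z ∷ []
    at-a with z∈D , _ , a∈z ← edge-at-i (here refl) =
      length≡1⇒singleton a-leaf (∈-edgesAt⁺ {D = D} z∈D a∈z)
    at-c : edgesAt D c ≡ z′ ∷ []
    at-c with z′∈D , _ , c∈z′ ← edge-at-i (there (here refl)) =
      length≡1⇒singleton c-leaf (∈-edgesAt⁺ {D = D} z′∈D c∈z′)
    a≢c : a ≢ c
    a≢c a≡c with refl ← trans (sym at-a) (trans (cong (edgesAt D) a≡c) at-c) = z≢z′ refl
    i≢i₀ : i ≢ i₀
    i≢i₀ refl with () ← trans (sym at-i) at-i₀
    ac≢ii₀ : pair a c a≢c ≢ pair i i₀ i≢i₀
    ac≢ii₀ = pair≢ (χ-pair-∉ a≢i a≢i₀)
      where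
      a≢i : a ≢ i
      a≢i = proj₁ (proj₂ (edge-at-i (here refl)))
      a≢i₀ : a ≢ i₀
      a≢i₀ refl with () ← trans (sym at-a) at-i₀

  covered-bound : (∀ i → deg D i ≢ 0) → n * 2 ≤ length D * 3
  covered-bound covered = begin
    n * 2
      ≤⟨ ∑-≥ 2 (λ i → shareA-receipt (edgesAt D i) (covered i)) ⟩
    ∑[ i < n ] ∑[ z ∈ edgesAt D i ] shareA (deg D i)
      ≡⟨ double-counting D (λ _ i → shareA (deg D i)) ⟩
    ∑[ z ∈ D ] (shareA (deg D (fst z)) + shareA (deg D (snd z)))
      ≤⟨ ∑∈-≤ 3 (λ z∈D → shareA-payment _ _ (no-isolated-edge z∈D)) ⟩
    length D * 3 ∎
    where open ℕ.≤-Reasoning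

  uncovered-bound : Unique D → ∀ {i₀} → deg D i₀ ≡ 0 → n * 3 ≤ length D * 4 + 3
  uncovered-bound unique {i₀} i₀-uncovered = begin
    n * 3
      ≤⟨ ∑-≥ 3 receipt ⟩
    ∑[ i < n ] (received i + δ i i₀ * 3)
      ≡⟨ ∑-distrib-+ received (λ i → δ i i₀ * 3) ⟩
    ∑[ i < n ] received i + ∑[ i < n ] (δ i i₀ * 3)
      ≡⟨ cong₂ _+_ (double-counting D share) (∑-δ i₀ (λ _ → 3)) ⟩
    ∑[ z ∈ D ] (share z (fst z) + share z (snd z)) + 3
      ≤⟨ ℕ.+-monoˡ-≤ 3 (∑∈-≤ 4 payment) ⟩
    length D * 4 + 3 ∎
    where
    open ℕ.≤-Reasoning
    share : Vertex n → Fin n → ℕ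
    share z i = shareB (deg D i) (deg D (other z i))
    received : Fin n → ℕ
    received i = ∑[ z ∈ edgesAt D i ] share z i
    at-i₀ : edgesAt D i₀ ≡ []
    at-i₀ = length≡0⇒≡[] i₀-uncovered
    receipt : ∀ i → 3 ≤ received i + δ i i₀ * 3
    receipt i with i Fin.≟ i₀
    ... | yes refl rewrite δ-refl {i = i} = ℕ.m≤n+m 3 (received i)
    ... | no i≢i₀ = ℕ.≤-trans
      (shareB-receipt (edgesAt D i) (λ z → deg D (other z i))
                      (λ i-uncovered → no-twins i≢i₀ (trans (length≡0⇒≡[] i-uncovered) (sym at-i₀)))
                      (no-cherry unique at-i₀))
      (ℕ.m≤m+n (received i) _)
    payment : ∀ {z} → z ∈ D → share z (fst z) + share z (snd z) ≤ 4
    payment {z} z∈D rewrite other-fst z | other-snd z = shareB-payment _ _ (no-isolated-edge z∈D)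

3n≤4m+3⇒2n≤3m : ∀ {n m} → 9 ≤ n → n * 3 ≤ m * 4 + 3 → 2 * n ≤ 3 * m
3n≤4m+3⇒2n≤3m {n} {m} 9≤n 3n≤4m+3 = ℕ.*-cancelˡ-≤ 4 (ℕ.+-cancelʳ-≤ 9 _ _ (begin
  4 * (2 * n) + 9  ≤⟨ ℕ.+-monoʳ-≤ (4 * (2 * n)) 9≤n ⟩
  4 * (2 * n) + n  ≡⟨ solve 1 (λ n → con 4 :* (con 2 :* n) :+ n := con 3 :* (n :* con 3)) refl n ⟩
  3 * (n * 3)      ≤⟨ ℕ.*-monoʳ-≤ 3 3n≤4m+3 ⟩
  3 * (m * 4 + 3)  ≡⟨ solve 1 (λ m → con 3 :* (m :* con 4 :+ con 3) := con 4 :* (con 3 :* m) :+ con 9) refl m ⟩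
  4 * (3 * m) + 9  ∎))
  where
  open ℕ.≤-Reasoning
  open +-*-Solver

lower-bound : ∀ {n} → 9 ≤ n → ∀ {D : List (Vertex n)} → Unique D → DoublyResolving D →
              2 * n ≤ 3 * length D
lower-bound {n} 9≤n {D} unique resolving = by-cases (Fin.any? (λ i → deg D i ≟ 0))
  where
  6≤n : 6 ≤ n
  6≤n = ℕ.≤-trans (ℕ.m≤m+n 6 3) 9≤n
  by-cases : Dec (∃[ i ] deg D i ≡ 0) → 2 * n ≤ 3 * length D
  by-cases (yes (i₀ , i₀-uncovered)) =
    3n≤4m+3⇒2n≤3m {m = length D} 9≤n (uncovered-bound 6≤n resolving unique i₀-uncovered)
  by-cases (no none-uncovered) =
    subst₂ _≤_ (ℕ.*-comm n 2) (ℕ.*-comm (length D) 3)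
           (covered-bound 6≤n resolving λ i i-uncovered → none-uncovered (i , i-uncovered))

-- Star partitions

-- `star x` is the star containing x; each star has a centre and two distinguished leaves, and
-- every other point is also a leaf, joined to the centre of its star by a leaf edge.
record StarPartition (n k : ℕ) : Set where
  field
    star                      : Fin n → Fin k
    centre leaf₁ leaf₂        : Fin k → Fin n
    star-centre               : ∀ j → star (centre j) ≡ j
    star-leaf₁                : ∀ j → star (leaf₁ j) ≡ j
    star-leaf₂                : ∀ j → star (leaf₂ j) ≡ j
    leaf₁≢centre              : ∀ j → leaf₁ j ≢ centre j
    leaf₂≢centre              : ∀ j → leaf₂ j ≢ centre j
    leaf₁≢leaf₂               : ∀ j → leaf₁ j ≢ leaf₂ j

  centreOf : Fin n → Fin n
  centreOf x = centre (star x)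

  SameOnLeafEdges : Vertex n → Vertex n → Set
  SameOnLeafEdges u v = ∀ {x} → x ≢ centreOf x → χ u x + χ u (centreOf x) ≡ χ v x + χ v (centreOf x)

  centreOf-leaf₁ : ∀ j → centreOf (leaf₁ j) ≡ centre j
  centreOf-leaf₁ j = cong centre (star-leaf₁ j)

  centreOf-leaf₂ : ∀ j → centreOf (leaf₂ j) ≡ centre j
  centreOf-leaf₂ j = cong centre (star-leaf₂ j)

  leaf-edge-through : ∀ y → ∃[ l ] l ≢ centreOf l × star l ≡ star y × (y ≡ l ⊎ y ≡ centreOf l)
  leaf-edge-through y with y Fin.≟ centreOf y
  ... | no  y-leaf   = y , y-leaf , refl , inj₁ refl
  ... | yes y-centre =
    leaf₁ (star y) , subst (leaf₁ (star y) ≢_) (sym (centreOf-leaf₁ (star y))) (leaf₁≢centre (star y)) ,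
    star-leaf₁ (star y) , inj₂ (trans y-centre (sym (centreOf-leaf₁ (star y))))

  -- The other point y of p lies on a leaf edge
  -- meeting p more often than q: twice against at most once if y is a leaf of star j, and once
  -- against never otherwise.
  star-clash : ∀ {p q} j → SameOnLeafEdges p q →
               χ p (centre j) ≡ 1 → χ q (leaf₁ j) ≡ 1 → χ q (leaf₂ j) ≡ 1 → ⊥
  star-clash {p} {q} j same c∈p l₁∈q l₂∈q with y≢c , y∈p ← χ-other {z = p} {i = centre j} c∈p
    = clash (star y Fin.≟ j)
    where
    y = other p (centre j)
    outside : ∀ {x} → star x ≢ j → χ q x ≡ 0
    outside {x} x∉j with χ-0or1 q x
    ... | inj₁ x∉q = x∉q
    ... | inj₂ x∈q with χ-two {q = q} (leaf₁≢leaf₂ j) l₁∈q l₂∈q x∈q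
    ...   | inj₁ refl = contradiction (star-leaf₁ j) x∉j
    ...   | inj₂ refl = contradiction (star-leaf₂ j) x∉j
    c∉q : χ q (centre j) ≡ 0
    c∉q with χ-0or1 q (centre j)
    ... | inj₁ c∉q = c∉q
    ... | inj₂ c∈q with χ-two {q = q} (leaf₁≢leaf₂ j) l₁∈q l₂∈q c∈q
    ...   | inj₁ c≡l₁ = contradiction (sym c≡l₁) (leaf₁≢centre j)
    ...   | inj₂ c≡l₂ = contradiction (sym c≡l₂) (leaf₂≢centre j)
    clash : Dec (star y ≡ j) → ⊥
    clash (yes y∈j) = contradiction (subst (_≤ 1) (sym two≡) (χ≤1 q y)) λ { (s≤s ()) }
      where
      cy≡c : centreOf y ≡ centre j
      cy≡c = cong centre y∈j
      two≡ : 2 ≡ χ q y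
      two≡ = begin
        2                            ≡⟨ cong₂ _+_ y∈p (trans (cong (χ p) cy≡c) c∈p) ⟨
        χ p y + χ p (centreOf y)     ≡⟨ same (subst (y ≢_) (sym cy≡c) y≢c) ⟩
        χ q y + χ q (centreOf y)     ≡⟨ cong (χ q y +_) (trans (cong (χ q) cy≡c) c∉q) ⟩
        χ q y + 0                    ≡⟨ ℕ.+-identityʳ (χ q y) ⟩
        χ q y                        ∎
        where open ≡-Reasoning
    clash (no y∉j) with l , l-leaf , sl≡sy , y∈l-edge ← leaf-edge-through y =
      contradiction (same l-leaf) (positive⇒≢0 y∈l-edge)
      where
      RHS≡0 : χ q l + χ q (centreOf l) ≡ 0
      RHS≡0 = cong₂ _+_ (outside (y∉j ∘ trans (sym sl≡sy)))
                        (outside (y∉j ∘ trans (sym (trans (star-centre (star l)) sl≡sy))))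
      positive⇒≢0 : y ≡ l ⊎ y ≡ centreOf l → χ p l + χ p (centreOf l) ≢ χ q l + χ q (centreOf l)
      positive⇒≢0 (inj₁ y≡l) eq =
        ℕ.1+n≢0 (trans (sym y∈p) (trans (cong (χ p) y≡l) (ℕ.m+n≡0⇒m≡0 _ (trans eq RHS≡0))))
      positive⇒≢0 (inj₂ y≡cl) eq =
        ℕ.1+n≢0 (trans (sym y∈p) (trans (cong (χ p) y≡cl) (ℕ.m+n≡0⇒n≡0 (χ p l) (trans eq RHS≡0))))

  leaf₁-leaf : ∀ j → leaf₁ j ≢ centreOf (leaf₁ j)
  leaf₁-leaf j = subst (leaf₁ j ≢_) (sym (centreOf-leaf₁ j)) (leaf₁≢centre j)

  leaf₂-leaf : ∀ j → leaf₂ j ≢ centreOf (leaf₂ j)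
  leaf₂-leaf j = subst (leaf₂ j ≢_) (sym (centreOf-leaf₂ j)) (leaf₂≢centre j)

  leaf-forced : ∀ {p q l} → l ≢ centreOf l → SameOnLeafEdges p q →
                χ p (centreOf l) ≡ 1 → χ q (centreOf l) ≡ 0 → χ q l ≡ 1
  leaf-forced {p} {q} {l} l-leaf same c∈p c∉q = suc≡≤1⇒≡1 (χ≤1 q l) (begin
    suc (χ p l)               ≡⟨ ℕ.+-comm 1 (χ p l) ⟩
    χ p l + 1                 ≡⟨ cong (χ p l +_) c∈p ⟨
    χ p l + χ p (centreOf l)  ≡⟨ same l-leaf ⟩
    χ q l + χ q (centreOf l)  ≡⟨ cong (χ q l +_) c∉q ⟩
    χ q l + 0                 ≡⟨ ℕ.+-identityʳ (χ q l) ⟩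
    χ q l                     ∎)
    where open ≡-Reasoning

  both-leaves-forced : ∀ {p q} j → SameOnLeafEdges p q →
                       χ p (centre j) ≡ 1 → χ q (centre j) ≡ 0 → ⊥
  both-leaves-forced {p} {q} j same c∈p c∉q =
    star-clash {p} {q} j same c∈p (forced (leaf₁-leaf j) (centreOf-leaf₁ j))
                                  (forced (leaf₂-leaf j) (centreOf-leaf₂ j))
    where
    forced : ∀ {l} → l ≢ centreOf l → centreOf l ≡ centre j → χ q l ≡ 1
    forced {l} l-leaf cl≡c =
      leaf-forced {p} {q} {l} l-leaf same (trans (cong (χ p) cl≡c) c∈p) (trans (cong (χ q) cl≡c) c∉q)

  difference-clash : ∀ {u v a} → SameOnLeafEdges u v → χ u a ≡ 1 → χ v a ≡ 0 → ⊥
  difference-clash {u} {v} {a} same a∈u a∉v with a Fin.≟ centreOf a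
  ... | yes a-centre = both-leaves-forced {u} {v} (star a) same (subst (λ x → χ u x ≡ 1) a-centre a∈u)
                                                         (subst (λ x → χ v x ≡ 0) a-centre a∉v)
  ... | no  a-leaf   = both-leaves-forced {v} {u} (star a) (λ l-leaf → sym (same l-leaf)) c∈v c∉u
    where
    edge-a : suc (χ u (centreOf a)) ≡ χ v (centreOf a)
    edge-a = trans (cong (_+ χ u (centreOf a)) (sym a∈u))
                   (trans (same a-leaf) (cong (_+ χ v (centreOf a)) a∉v))
    c∈v : χ v (centreOf a) ≡ 1
    c∈v = suc≡≤1⇒≡1 (χ≤1 v (centreOf a)) edge-a
    c∉u : χ u (centreOf a) ≡ 0
    c∉u = ℕ.suc-injective (trans edge-a c∈v)

  leaf-edges-separate : ∀ {u v} → SameOnLeafEdges u v → u ≡ v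
  leaf-edges-separate {u} {v} same with χ-0or1 v (fst u) | χ-0or1 v (snd u)
  ... | inj₂ fst∈v | inj₂ snd∈v = ⊆⇒≡ fst∈v snd∈v
  ... | inj₁ fst∉v | _          = ⊥-elim (difference-clash {u} {v} same (χ-fst u) fst∉v)
  ... | inj₂ _     | inj₁ snd∉v = ⊥-elim (difference-clash {u} {v} same (χ-snd u) snd∉v)

  module _ (6≤n : 6 ≤ n) (4<k : 4 < k) {D : List (Vertex n)}
           (leaf-edge∈D : ∀ {x} (x-leaf : x ≢ centreOf x) → pair x (centreOf x) x-leaf ∈ D) where

    separating : ∀ {u v} → u ≢ v → ∃[ w ] w ∈ D × ∣ u ∩ w ∣ ≢ ∣ v ∩ w ∣
    separating {u} {v} u≢v =
      find (¬All⇒Any¬ (λ w → ∣ u ∩ w ∣ ≟ ∣ v ∩ w ∣) D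
                      (u≢v ∘ leaf-edges-separate {u} {v} ∘ same-on-leaf-edges))
      where
      same-on-leaf-edges : All (λ w → ∣ u ∩ w ∣ ≡ ∣ v ∩ w ∣) D → SameOnLeafEdges u v
      same-on-leaf-edges unseparated {x} x-leaf = begin
        χ u x + χ u (centreOf x)               ≡⟨ ∣∩pair∣ u x (centreOf x) x-leaf ⟨
        ∣ u ∩ pair x (centreOf x) x-leaf ∣      ≡⟨ All.lookup unseparated (leaf-edge∈D x-leaf) ⟩
        ∣ v ∩ pair x (centreOf x) x-leaf ∣      ≡⟨ ∣∩pair∣ v x (centreOf x) x-leaf ⟩
        χ v x + χ v (centreOf x)               ∎
        where open ≡-Reasoning

    leaf-edge-avoids : ∀ {w l} (l-leaf : l ≢ centreOf l) →
                       star (fst w) ≢ star l → star (snd w) ≢ star l →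
                       ∣ w ∩ pair l (centreOf l) l-leaf ∣ ≡ 0
    leaf-edge-avoids {w} {l} l-leaf fst∉ snd∉ =
      trans (∣∩pair∣ w l (centreOf l) l-leaf) (cong₂ _+_ (outside refl) (outside (star-centre (star l))))
      where
      outside : ∀ {x} → star x ≡ star l → χ w x ≡ 0
      outside sx≡sl = χ-∉ {z = w} (λ x≡fst → fst∉ (trans (cong star (sym x≡fst)) sx≡sl))
                                 (λ x≡snd → snd∉ (trans (cong star (sym x≡snd)) sx≡sl))

    balancing : ∀ u v → ∃[ w ] w ∈ D × ∣ u ∩ w ∣ ≡ ∣ v ∩ w ∣
    balancing u v
      with j , j∉ ← fresh (star (fst u) ∷ star (snd u) ∷ star (fst v) ∷ star (snd v) ∷ []) 4<k
      with j≢u₁ ∷ j≢u₂ ∷ j≢v₁ ∷ j≢v₂ ∷ [] ← ¬Any⇒All¬ _ j∉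
      = pair (leaf₁ j) (centreOf (leaf₁ j)) (leaf₁-leaf j) , leaf-edge∈D (leaf₁-leaf j) ,
        trans (leaf-edge-avoids {u} (leaf₁-leaf j) (off j≢u₁) (off j≢u₂))
              (sym (leaf-edge-avoids {v} (leaf₁-leaf j) (off j≢v₁) (off j≢v₂)))
      where
      off : ∀ {i} → j ≢ i → i ≢ star (leaf₁ j)
      off j≢i i≡ = j≢i (sym (trans i≡ (star-leaf₁ j)))

    leaf-edges-resolving : DoublyResolving D
    leaf-edges-resolving = DoublyResolving-if 6≤n separating balancing

-- The upper bound

-- The k * 2 + r leaves come first (leaf s of star j is combine j s, then r extra leaves of star
-- j₀) and the k centres last, so every leaf edge lists its leaf before its centre.
module Blocks (k r : ℕ) (j₀ : Fin k) where

  L : ℕ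
  L = k * 2 + r

  leafStar : Fin L → Fin k
  leafStar i = [ quotient 2 , (λ _ → j₀) ]′ (splitAt (k * 2) i)

  star : Fin (L + k) → Fin k
  star x = [ leafStar , id ]′ (splitAt L x)

  leaf : Fin k → Fin 2 → Fin (L + k)
  leaf j s = (combine j s ↑ˡ r) ↑ˡ k

  star-leaf : ∀ j s → star (leaf j s) ≡ j
  star-leaf j s = begin
    [ leafStar , id ]′ (splitAt L ((combine j s ↑ˡ r) ↑ˡ k))
      ≡⟨ cong [ leafStar , id ]′ (Fin.splitAt-↑ˡ L _ k) ⟩
    leafStar (combine j s ↑ˡ r)
      ≡⟨ cong [ quotient 2 , _ ]′ (Fin.splitAt-↑ˡ (k * 2) _ r) ⟩
    quotient 2 (combine j s)
      ≡⟨ cong proj₁ (Fin.remQuot-combine j s) ⟩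
    j ∎
    where open ≡-Reasoning

  leaf≢centre : ∀ i j → i ↑ˡ k ≢ L ↑ʳ j
  leaf≢centre i j eq
    with () ← trans (sym (Fin.splitAt-↑ˡ L i k)) (trans (cong (splitAt L) eq) (Fin.splitAt-↑ʳ L k j))

  partition : StarPartition (L + k) k
  partition = record
    { star         = star
    ; centre       = L ↑ʳ_
    ; leaf₁        = λ j → leaf j 0F
    ; leaf₂        = λ j → leaf j 1F
    ; star-centre  = λ j → cong [ leafStar , id ]′ (Fin.splitAt-↑ʳ L k j)
    ; star-leaf₁   = λ j → star-leaf j 0F
    ; star-leaf₂   = λ j → star-leaf j 1F
    ; leaf₁≢centre = λ j → leaf≢centre _ j
    ; leaf₂≢centre = λ j → leaf≢centre _ j
    ; leaf₁≢leaf₂  = λ j eq → case01 (Fin.combine-injectiveʳ j 0F j 1F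
                                  (Fin.↑ˡ-injective r _ _ (Fin.↑ˡ-injective k _ _ eq)))
    }
    where
    case01 : 0F ≢ 1F
    case01 ()

  open StarPartition partition using (centreOf; leaf-edges-resolving)

  leaf<centre : ∀ (i : Fin L) (j : Fin k) → toℕ (i ↑ˡ k) < toℕ (L ↑ʳ j)
  leaf<centre i j rewrite Fin.toℕ-↑ˡ i k | Fin.toℕ-↑ʳ L j = ℕ.≤-trans (Fin.toℕ<n i) (ℕ.m≤m+n L (toℕ j))

  leafEdge : Fin L → Vertex (L + k)
  leafEdge i = (i ↑ˡ k , L ↑ʳ leafStar i) , leaf<centre i (leafStar i)

  edges : List (Vertex (L + k))
  edges = tabulate leafEdge

  edges-unique : Unique edges
  edges-unique = Unique.tabulate⁺ (Fin.↑ˡ-injective k _ _ ∘ cong fst)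

  length-edges : length edges ≡ L
  length-edges = length-tabulate leafEdge

  leaf-edge∈edges : ∀ {x} (x-leaf : x ≢ centreOf x) → pair x (centreOf x) x-leaf ∈ edges
  leaf-edge∈edges {x} x-leaf with splitAt L x in split
  ... | inj₂ j = contradiction (sym (Fin.splitAt⁻¹-↑ʳ split)) x-leaf
  ... | inj₁ i with refl ← Fin.splitAt⁻¹-↑ˡ split
    rewrite Fin.splitAt-↑ˡ L i k
    with fst≡ , snd≡ ← pair-< x-leaf (leaf<centre i (leafStar i))
    = subst (_∈ edges) (sym (vertex-≡ fst≡ snd≡)) (∈-tabulate⁺ i)

[x*3+s]/3≡x : ∀ x {s} → s < 3 → (x * 3 + s) / 3 ≡ x
[x*3+s]/3≡x x {s} s<3 = begin
  (x * 3 + s) / 3    ≡⟨ +-distrib-/-∣ˡ s (divides x refl) ⟩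
  x * 3 / 3 + s / 3  ≡⟨ cong₂ _+_ (m*n/n≡m x 3) (m<n⇒m/n≡0 s<3) ⟩
  x + 0              ≡⟨ ℕ.+-identityʳ x ⟩
  x                  ∎
  where open ≡-Reasoning

ceil2n/3-≤ : ∀ {n m} → 2 * n ≤ 3 * m → ceil2n/3 n ≤ m
ceil2n/3-≤ {n} {m} 2n≤3m = begin
  (2 * n + 2) / 3  ≤⟨ /-monoˡ-≤ 3 (ℕ.+-monoˡ-≤ 2 2n≤3m) ⟩
  (3 * m + 2) / 3  ≡⟨ cong (λ t → (t + 2) / 3) (ℕ.*-comm 3 m) ⟩
  (m * 3 + 2) / 3  ≡⟨ [x*3+s]/3≡x m (s≤s (s≤s (s≤s z≤n))) ⟩
  m                ∎
  where open ℕ.≤-Reasoning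

ceil2n/3-[3k+r] : ∀ k r → r < 3 → ceil2n/3 ((k * 2 + r) + k) ≡ k * 2 + r
ceil2n/3-[3k+r] k r r<3 = begin
  (2 * ((k * 2 + r) + k) + 2) / 3        ≡⟨ cong (λ t → (2 * ((k * 2 + r) + k) + t) / 3) r+s≡2 ⟨
  (2 * ((k * 2 + r) + k) + (r + s)) / 3  ≡⟨ cong (_/ 3) (solve 3 (λ k r s →
                                              con 2 :* ((k :* con 2 :+ r) :+ k) :+ (r :+ s)
                                              := (k :* con 2 :+ r) :* con 3 :+ s) refl k r s) ⟩
  ((k * 2 + r) * 3 + s) / 3              ≡⟨ [x*3+s]/3≡x (k * 2 + r) (s≤s (ℕ.m∸n≤m 2 r)) ⟩
  k * 2 + r                              ∎
  where
  open ≡-Reasoning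
  open +-*-Solver
  s = 2 ∸ r
  r+s≡2 : r + s ≡ 2
  r+s≡2 = ℕ.m+[n∸m]≡n (ℕ.≤-pred r<3)

ResolvingSetOfSize : ℕ → ℕ → Set
ResolvingSetOfSize n m = Σ (List (Vertex n)) λ D → Unique D × DoublyResolving D × length D ≡ m

optimal-set : ∀ k r → 5 ≤ k → r < 3 → ResolvingSetOfSize ((k * 2 + r) + k) (ceil2n/3 ((k * 2 + r) + k))
optimal-set k r 5≤k r<3 =
  edges , edges-unique , leaf-edges-resolving 6≤N 5≤k leaf-edge∈edges ,
  trans length-edges (sym (ceil2n/3-[3k+r] k r r<3))
  where
  open Blocks k r (fromℕ< (ℕ.≤-trans (s≤s z≤n) 5≤k))
  open StarPartition partition using (leaf-edges-resolving)
  6≤N : 6 ≤ (k * 2 + r) + k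
  6≤N = ℕ.≤-trans (ℕ.*-monoˡ-≤ 2 (ℕ.≤-trans (ℕ.n≤1+n 3) (ℕ.≤-trans (ℕ.n≤1+n 4) 5≤k)))
                  (ℕ.≤-trans (ℕ.m≤m+n (k * 2) r) (ℕ.m≤m+n (k * 2 + r) k))

theorem8 : ∀ (n : ℕ) → 15 ≤ n → IsPsi n (ceil2n/3 n)
theorem8 n 15≤n = witness , λ D unique resolving → ceil2n/3-≤ {n} (lower-bound 9≤n unique resolving)
  where
  9≤n : 9 ≤ n
  9≤n = ℕ.≤-trans (ℕ.m≤m+n 9 6) 15≤n
  n≡[3k+r] : (n / 3 * 2 + n % 3) + n / 3 ≡ n
  n≡[3k+r] = trans (solve 2 (λ k r → (k :* con 2 :+ r) :+ k := r :+ k :* con 3) refl (n / 3) (n % 3))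
                   (sym (m≡m%n+[m/n]*n n 3))
    where open +-*-Solver
  witness : ResolvingSetOfSize n (ceil2n/3 n)
  witness = subst (λ N → ResolvingSetOfSize N (ceil2n/3 N)) n≡[3k+r]
                  (optimal-set (n / 3) (n % 3) (/-monoˡ-≤ 3 15≤n) (m%n<n n 3))
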